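{- For every constant $k\ge 2$ there is a constant $c$ such that the following holds. Assume $f\colon\{0,1\}^n\to\{0,1\}$, $f\in R_k$, and $C\le f$ is a circuit consisting only of $\mathrm{THR}^{k+1}_2$ gates and literals. Then there is a protocol $\pi$ computing the $R_k$-communication game for $f$ with $\mathrm{depth}(\pi)\le c\cdot\mathrm{depth}(C)$.
   Context: $R_k$ is the set of $f$ such that any $x^1,\dots,x^k\in f^{ -1}(0)$ have a coordinate $i$ with $x^1_i=\dots=x^k_i$. $\mathrm{THR}^{k+1}_2$ outputs $1$ iff at least $2$ of its $k+1$ inputs are $1$. A circuit consisting only of $\mathrm{THR}^{k+1}_2$ gates and literals is a DAG with an output node, internal nodes $\mathrm{THR}^{k+1}_2$ gates with $k+1$ ordered inputs, input nodes labeled by literals $x_i$ or $\neg x_i$ (no constants); depth = longest output-to-input path (negations not counted). $C\le f$ means $C(x)=0$ for all $x\in f^{ -1}(0)$. The $R_k$-communication game for $f$: party $j\in[k]$ gets $x^j\in f^{ -1}(0)$, and they must output $(i,b)\in[n]\times\{0,1\}$ with $x^1_i=\dots=x^k_i=b$. A protocol is a deterministic $k$-party number-in-hand protocol in which at each node one party broadcasts one bit depending on its input; its depth is the maximal number of bits communicated; it computes the game if it always outputs a correct answer. -}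

module Defs where

open import Data.Nat using (ℕ; zero; suc; _+_; _*_; _≤_; _⊔_)
open import Data.Bool using (Bool; true; false; if_then_else_; not)
open import Data.Fin using (Fin; zero; suc)
open import Data.Product using (Σ; _×_; _,_; ∃; ∃-syntax)
open import Relation.Binary.PropositionalEquality using (_≡_)

-- Points of {0,1}^n (true = 1, false = 0) and Boolean functions on them.
Point : ℕ → Set
Point n = Fin n → Bool

BFun : ℕ → Set
BFun n = Point n → Bool

InR : (k n : ℕ) → BFun n → Set
InR k n f = (xs : Fin k → Point n) → (∀ j → f (xs j) ≡ false) →
            ∃[ i ] (∀ j j' → xs j i ≡ xs j' i)

countTrue : ∀ {m} → (Fin m → Bool) → ℕ
countTrue {zero} v = 0
countTrue {suc m} v = (if v zero then 1 else 0) + countTrue (λ i → v (suc i))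

maxF : ∀ {m} → (Fin m → ℕ) → ℕ
maxF {zero} v = 0
maxF {suc m} v = v zero ⊔ maxF (λ i → v (suc i))

THR2 : ∀ {m} → (Fin m → Bool) → Bool
THR2 v with countTrue v
... | zero = false
... | suc zero = false
... | suc (suc _) = true

-- Circuits as DAGs, presented in topological order: node number j is either a
-- literal (x_i if the polarity is true, ¬x_i if false) or a THR^{k+1}_2 gate whose
-- k+1 ordered inputs are nodes with smaller numbers (Fin j).
data Node (k n : ℕ) (j : ℕ) : Set where
  lit : Fin n → Bool → Node k n j
  thr : (Fin (suc k) → Fin j) → Node k n j

data Nodes (k n : ℕ) : ℕ → Set where
  []  : Nodes k n 0
  _▷_ : ∀ {m} → Nodes k n m → Node k n m → Nodes k n (suc m)

snocF : ∀ {A : Set} {m} → (Fin m → A) → A → Fin (suc m) → A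
snocF {m = zero} v a zero = a
snocF {m = suc m} v a zero = v zero
snocF {m = suc m} v a (suc i) = snocF (λ i → v (suc i)) a i

litVal : ∀ {n} → Fin n → Bool → Point n → Bool
litVal i true x = x i
litVal i false x = not (x i)

values : ∀ {k n m} → Nodes k n m → Point n → Fin m → Bool
values [] x ()
values (ns ▷ lit i b) x = snocF (values ns x) (litVal i b x)
values (ns ▷ thr ch) x = snocF (values ns x) (THR2 (λ t → values ns x (ch t)))

-- length of the longest path from a node down to an input node
-- (literal nodes, including negations, have depth 0)
depths : ∀ {k n m} → Nodes k n m → Fin m → ℕ
depths [] ()
depths (ns ▷ lit i b) = snocF (depths ns) 0
depths (ns ▷ thr ch) = snocF (depths ns) (suc (maxF (λ t → depths ns (ch t))))

record Circuit (k n : ℕ) : Set where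
  constructor circuit
  field
    size   : ℕ
    nodes  : Nodes k n size
    output : Fin size

evalC : ∀ {k n} → Circuit k n → Point n → Bool
evalC (circuit _ ns o) x = values ns x o

depthC : ∀ {k n} → Circuit k n → ℕ
depthC (circuit _ ns o) = depths ns o

_≤C_ : ∀ {k n} → Circuit k n → BFun n → Set
C ≤C f = ∀ x → f x ≡ false → evalC C x ≡ false

-- Deterministic k-party number-in-hand protocol trees: at an internal node,
-- party j broadcasts a bit depending only on its own input; leaves output (i , b).
data Protocol (k n : ℕ) : Set where
  leaf : Fin n → Bool → Protocol k n
  node : Fin k → (Point n → Bool) → Protocol k n → Protocol k n → Protocol k n

run : ∀ {k n} → Protocol k n → (Fin k → Point n) → Fin n × Bool
run (leaf i b) xs = i , b
run (node j g p₀ p₁) xs = if g (xs j) then run p₁ xs else run p₀ xs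

depthP : ∀ {k n} → Protocol k n → ℕ
depthP (leaf _ _) = 0
depthP (node _ _ p₀ p₁) = suc (depthP p₀ ⊔ depthP p₁)

Computes : ∀ {k n} → Protocol k n → BFun n → Set
Computes {k} {n} π f = (xs : Fin k → Point n) → (∀ j → f (xs j) ≡ false) →
  Σ (Fin n × Bool) λ { (i , b) → run π xs ≡ (i , b) × (∀ j → xs j i ≡ b) }

-- Every node v of the circuit C gets a protocol π_v solving the game
-- "find a coordinate on which all k inputs agree" under the promise that each
-- party's input is a zero of v.  A literal node x_i^b (zero iff x_i = ¬b) is solved
-- by the leaf (i , ¬b) without communication.  At a gate v = THR_2(v_0, …, v_k)
-- each party's input is a zero of v, so it makes at most one child true; by the
-- pigeonhole principle (k parties, k+1 children) some child v_t is false on all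
-- k inputs.  The parties find the first such child (each child costs k broadcast
-- bits, (k+1)·k in total) and continue with π_{v_t}.  Hence depth(π_v) is at most
-- (k+1)·k·depth(v), and since C ≤ f every zero of f is a zero of the output node.
module Submission where

open import Defs
open import Data.Nat using (ℕ; zero; suc; _+_; _*_; _≤_; z≤n; s≤s)
open import Data.Nat.Properties
  using (≤-trans; m≤n+m; *-suc; +-assoc; ⊔-lub; m≤m⊔n; m≤n⊔m; *-monoʳ-≤; n<1+n)
open import Data.Fin using (Fin; zero; suc)
open import Data.Fin.Properties using (pigeonhole; <⇒≢)
open import Data.Bool using (Bool; true; false; not)
open import Data.Bool.Properties using (not-injective)
open import Data.Product using (Σ; _×_; ∃-syntax; _,_; proj₁; proj₂)
open import Data.Sum using (_⊎_; inj₁; inj₂)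
open import Data.Empty using (⊥; ⊥-elim)
open import Relation.Binary.PropositionalEquality using (_≡_; _≢_; refl; sym; trans; subst; cong)

maxF-upper : ∀ {m} (v : Fin m → ℕ) (i : Fin m) → v i ≤ maxF v
maxF-upper v zero    = m≤m⊔n (v zero) _
maxF-upper v (suc i) = ≤-trans (maxF-upper (λ j → v (suc j)) i) (m≤n⊔m (v zero) _)

countTrue-≥1 : ∀ {m} (v : Fin m → Bool) (a : Fin m) → v a ≡ true → 1 ≤ countTrue v
countTrue-≥1 v zero va rewrite va = s≤s z≤n
countTrue-≥1 v (suc a) va with v zero
... | true  = s≤s z≤n
... | false = countTrue-≥1 (λ i → v (suc i)) a va

countTrue-≥2 : ∀ {m} (v : Fin m → Bool) (a b : Fin m) → a ≢ b →
               v a ≡ true → v b ≡ true → 2 ≤ countTrue v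
countTrue-≥2 v zero zero a≢b _ _ = ⊥-elim (a≢b refl)
countTrue-≥2 v zero (suc b) _ va vb rewrite va = s≤s (countTrue-≥1 (λ i → v (suc i)) b vb)
countTrue-≥2 v (suc a) zero _ va vb rewrite vb = s≤s (countTrue-≥1 (λ i → v (suc i)) a va)
countTrue-≥2 v (suc a) (suc b) a≢b va vb with v zero
... | true  = ≤-trans (countTrue-≥2 (λ i → v (suc i)) a b (λ q → a≢b (cong suc q)) va vb)
                      (m≤n+m _ 1)
... | false = countTrue-≥2 (λ i → v (suc i)) a b (λ q → a≢b (cong suc q)) va vb

THR2-≥2 : ∀ {m} (v : Fin m → Bool) → 2 ≤ countTrue v → THR2 v ≡ true
THR2-≥2 v two with countTrue v
THR2-≥2 v ()         | zero
THR2-≥2 v (s≤s ())   | suc zero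
...                  | suc (suc _) = refl

not-every-child-hit : ∀ {k n} (g : Fin (suc k) → Point n → Bool) (xs : Fin k → Point n) →
  (∀ j → THR2 (λ t → g t (xs j)) ≡ false) → (∀ t → ∃[ j ] g t (xs j) ≡ true) → ⊥
not-every-child-hit {k} g xs gate-off hit
  with t , t' , t<t' , same-party ← pigeonhole (n<1+n k) (λ t → proj₁ (hit t)) =
  true≢false (trans (sym fires) (gate-off j))
  where
    j : Fin k
    j = proj₁ (hit t)

    hit-t' : g t' (xs j) ≡ true
    hit-t' = subst (λ j' → g t' (xs j') ≡ true) (sym same-party) (proj₂ (hit t'))

    fires : THR2 (λ s → g s (xs j)) ≡ true
    fires = THR2-≥2 (λ s → g s (xs j))
              (countTrue-≥2 (λ s → g s (xs j)) t t' (<⇒≢ t<t') (proj₂ (hit t)) hit-t')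

    true≢false : true ≢ false
    true≢false ()

module Protocols {k n : ℕ} where

  Correct : (Fin k → Point n) → Fin n × Bool → Set
  Correct xs r = ∀ j → xs j (proj₁ r) ≡ proj₂ r

  Solves : (Point n → Bool) → Protocol k n → Set
  Solves val π = ∀ xs → (∀ j → val (xs j) ≡ false) → Correct xs (run π xs)

  askParties : ∀ m → (Fin m → Fin k) → (Point n → Bool) →
               Protocol k n → Protocol k n → Protocol k n
  askParties zero    p h y no = y
  askParties (suc m) p h y no = node (p zero) h (askParties m (λ i → p (suc i)) h y no) no

  askParties-run : ∀ m p h y no (xs : Fin k → Point n) →
    ((∀ i → h (xs (p i)) ≡ false) × run (askParties m p h y no) xs ≡ run y xs) ⊎
    ((∃[ i ] h (xs (p i)) ≡ true) × run (askParties m p h y no) xs ≡ run no xs)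
  askParties-run zero p h y no xs = inj₁ ((λ ()) , refl)
  askParties-run (suc m) p h y no xs with h (xs (p zero)) in hp₀
  ... | true = inj₂ ((zero , hp₀) , refl)
  ... | false with askParties-run m (λ i → p (suc i)) h y no xs
  ...   | inj₁ (silent , r)     = inj₁ ((λ { zero → hp₀ ; (suc i) → silent i }) , r)
  ...   | inj₂ ((i , hit) , r)  = inj₂ ((suc i , hit) , r)

  askParties-depth : ∀ m p h y no D → depthP y ≤ D → depthP no ≤ D →
                     depthP (askParties m p h y no) ≤ m + D
  askParties-depth zero    p h y no D dy dno = dy
  askParties-depth (suc m) p h y no D dy dno =
    s≤s (⊔-lub (askParties-depth m (λ i → p (suc i)) h y no D dy dno) (≤-trans dno (m≤n+m D m)))

  findSilent : ∀ m → (Fin m → Point n → Bool) → (Fin m → Protocol k n) →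
               Protocol k n → Protocol k n
  findSilent zero    hs qs fallback = fallback
  findSilent (suc m) hs qs fallback =
    askParties k (λ j → j) (hs zero) (qs zero)
      (findSilent m (λ t → hs (suc t)) (λ t → qs (suc t)) fallback)

  findSilent-run : ∀ m hs qs fallback (xs : Fin k → Point n) →
    (∃[ t ] ((∀ j → hs t (xs j) ≡ false) × run (findSilent m hs qs fallback) xs ≡ run (qs t) xs)) ⊎
    (∀ t → ∃[ j ] hs t (xs j) ≡ true)
  findSilent-run zero hs qs fallback xs = inj₂ (λ ())
  findSilent-run (suc m) hs qs fallback xs
    with askParties-run k (λ j → j) (hs zero) (qs zero)
           (findSilent m (λ t → hs (suc t)) (λ t → qs (suc t)) fallback) xs
  ... | inj₁ (silent , r) = inj₁ (zero , silent , r)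
  ... | inj₂ (hit₀ , r) with findSilent-run m (λ t → hs (suc t)) (λ t → qs (suc t)) fallback xs
  ...   | inj₁ (t , silent , r') = inj₁ (suc t , silent , trans r r')
  ...   | inj₂ hit              = inj₂ (λ { zero → hit₀ ; (suc t) → hit t })

  findSilent-depth : ∀ m hs qs fallback D → (∀ t → depthP (qs t) ≤ D) → depthP fallback ≤ D →
                     depthP (findSilent m hs qs fallback) ≤ m * k + D
  findSilent-depth zero hs qs fallback D dqs dfb = dfb
  findSilent-depth (suc m) hs qs fallback D dqs dfb =
    subst (depthP (findSilent (suc m) hs qs fallback) ≤_) (sym (+-assoc k (m * k) D))
      (askParties-depth k (λ j → j) (hs zero) (qs zero) _ (m * k + D)
        (≤-trans (dqs zero) (m≤n+m D (m * k)))
        (findSilent-depth m (λ t → hs (suc t)) (λ t → qs (suc t)) fallback D (λ t → dqs (suc t)) dfb))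

  -- A literal x_i^b vanishes exactly when x_i = ¬b, so (i , ¬b) is always correct.
  literal-solves : (i : Fin n) (b : Bool) → Solves (litVal i b) (leaf i (not b))
  literal-solves i true  xs vanish = vanish
  literal-solves i false xs vanish = λ j → not-injective (vanish j)

  -- The protocol of a gate THR_2(g_0, …, g_k): find a child silent for all parties
  -- and run its protocol (the fallback is never reached, by the pigeonhole step).
  gateProtocol : (Fin (suc k) → Point n → Bool) → (Fin (suc k) → Protocol k n) → Protocol k n
  gateProtocol g ps = findSilent (suc k) g ps (ps zero)

  gate-solves : (g : Fin (suc k) → Point n → Bool) (ps : Fin (suc k) → Protocol k n) →
                (∀ t → Solves (g t) (ps t)) → Solves (λ x → THR2 (λ t → g t x)) (gateProtocol g ps)
  gate-solves g ps solves xs gate-off with findSilent-run (suc k) g ps (ps zero) xs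
  ... | inj₁ (t , silent , r) = subst (Correct xs) (sym r) (solves t xs silent)
  ... | inj₂ hit              = ⊥-elim (not-every-child-hit g xs gate-off hit)

  gate-depth : (g : Fin (suc k) → Point n → Bool) (ps : Fin (suc k) → Protocol k n) (D : ℕ) →
               (∀ t → depthP (ps t) ≤ D) → depthP (gateProtocol g ps) ≤ suc k * k + D
  gate-depth g ps D dps = findSilent-depth (suc k) g ps (ps zero) D dps (dps zero)

open Protocols

module NodeProtocols {k n : ℕ} where

  prots : ∀ {m} → Nodes k n m → Fin m → Protocol k n
  prots [] ()
  prots (ns ▷ lit i b) = snocF (prots ns) (leaf i (not b))
  prots (ns ▷ thr ch)  =
    snocF (prots ns) (gateProtocol (λ t x → values ns x (ch t)) (λ t → prots ns (ch t)))

  snocF-all : ∀ {m} (P : (Point n → Bool) → Protocol k n → ℕ → Set)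
    {vals : Point n → Fin m → Bool} {ps : Fin m → Protocol k n} {ds : Fin m → ℕ}
    {val : Point n → Bool} {p : Protocol k n} {d : ℕ} →
    (∀ i → P (λ x → vals x i) (ps i) (ds i)) → P val p d →
    ∀ i → P (λ x → snocF (vals x) (val x) i) (snocF ps p i) (snocF ds d i)
  snocF-all {zero}  P old new zero    = new
  snocF-all {suc m} P old new zero    = old zero
  snocF-all {suc m} P old new (suc i) = snocF-all P (λ i → old (suc i)) new i

  NodeSpec : ℕ → (Point n → Bool) → Protocol k n → ℕ → Set
  NodeSpec c val π d = Solves val π × depthP π ≤ c * d

  gate-spec : (g : Fin (suc k) → Point n → Bool) (ps : Fin (suc k) → Protocol k n)
    (ds : Fin (suc k) → ℕ) → (∀ t → NodeSpec (suc k * k) (g t) (ps t) (ds t)) →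
    NodeSpec (suc k * k) (λ x → THR2 (λ t → g t x)) (gateProtocol g ps) (suc (maxF ds))
  gate-spec g ps ds children =
    gate-solves g ps (λ t → proj₁ (children t)) ,
    subst (depthP (gateProtocol g ps) ≤_) (sym (*-suc (suc k * k) (maxF ds)))
      (gate-depth g ps (suc k * k * maxF ds) child-depth)
    where
      child-depth : ∀ t → depthP (ps t) ≤ suc k * k * maxF ds
      child-depth t = ≤-trans (proj₂ (children t)) (*-monoʳ-≤ (suc k * k) (maxF-upper ds t))

  prots-spec : ∀ {m} (ns : Nodes k n m) (i : Fin m) →
               NodeSpec (suc k * k) (λ x → values ns x i) (prots ns i) (depths ns i)
  prots-spec [] ()
  prots-spec (ns ▷ lit i b) =
    snocF-all (NodeSpec (suc k * k)) {vals = values ns} {val = litVal i b} (prots-spec ns)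
      (literal-solves i b , z≤n)
  prots-spec (ns ▷ thr ch)  =
    snocF-all (NodeSpec (suc k * k)) {vals = values ns}
      {val = λ x → THR2 (λ t → values ns x (ch t))} (prots-spec ns)
      (gate-spec (λ t x → values ns x (ch t)) (λ t → prots ns (ch t))
                 (λ t → depths ns (ch t)) (λ t → prots-spec ns (ch t)))

open NodeProtocols

proposition8 : (k : ℕ) → 2 ≤ k → ∃[ c ] (∀ (n : ℕ) (f : BFun n) → InR k n f →
    (C : Circuit k n) → C ≤C f →
    Σ (Protocol k n) λ π → (Computes π f × depthP π ≤ c * depthC C))
proposition8 k _ = suc k * k , λ { n f _ (circuit _ ns out) C≤f →
  let solves , depth-bound = prots-spec ns out
  in prots ns out ,
     (λ xs zeros → run (prots ns out) xs , refl , solves xs (λ j → C≤f (xs j) (zeros j))) ,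
     depth-bound }
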